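{- Let $G$ be a directed graph. The data-program pair $(D_{tc}(G),P_{tc})$ has a unique model that consists of (1) all atoms in $D_{tc}(G)$, (2) all atoms $path(x,y,z,i)$ such that there is a path in $G$ from $x$ to $y$ of length $i$ and with $z$ being the last but one vertex on this path, and (3) all atoms $tc(x,y)$ such that there is a directed path of positive length from $x$ to $y$ in $G$.
   Context: Setting (logic PS): a rule is a formula $A_1\wedge\ldots\wedge A_m \rightarrow B_1\vee\ldots\vee B_n$ whose free variables are implicitly universally quantified; atoms in the consequent may contain the underscore symbol `_`, each occurrence standing for an existentially quantified variable (e.g. $path(X,Y,\_,\_)$ stands for $\exists W_1,W_2\, path(X,Y,W_1,W_2)$). A data-program pair $(D,P)$ consists of a finite set $D$ of ground atoms (data) and a finite set $P$ of rules (program). A set $M$ of ground atoms is a model of $(D,P)$ if it is a Herbrand model (over the constants appearing in $D\cup P$) of $cl(D)\cup P$, where $cl(D)$ contains $\top\rightarrow p(t)$ for every $p(t)\in D$ and $p(t)\rightarrow\bot$ for every other ground atom $p(t)$ whose relation symbol $p$ occurs in $D$ (closed-world assumption). Predefined relations (equality, $+$) are interpreted with their intended meaning; arithmetic expressions inside atoms are shorthand for extra variables constrained by predefined atoms; ground predefined atoms are omitted when describing models. $G=(V,E)$ is a finite directed graph without loops; the transitive closure relation holds for $(x,y)$ iff there is a directed path of length at least 1 from $x$ to $y$. Encoding: $D_{tc}(G) = \{vtx(v)\colon v\in V\} \cup \{edge(v,w)\colon (v,w)\in E\} \cup \{index(i)\colon 1\leq i\leq k\}$, where the indices are the integers $\{1,\ldots,|V|\}$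 used to count edges on paths (i.e. $k=|V|$). The program $P_{tc}$ consists of the rules TC1: $path(X,Y,Z,I) \rightarrow vtx(X)$; TC2: $path(X,Y,Z,I) \rightarrow vtx(Y)$; TC3: $path(X,Y,Z,I) \rightarrow vtx(Z)$; TC4: $path(X,Y,Z,I) \rightarrow index(I)$; TC5: $tc(X,Y) \rightarrow vtx(X)$; TC6: $tc(X,Y) \rightarrow vtx(Y)$; TC7: $path(X,Y,X,1) \rightarrow edge(X,Y)$; TC8: $edge(X,Y) \rightarrow path(X,Y,X,1)$; TC9: $path(X,Y,Z,1) \rightarrow X=Z$; TC10: $path(X,Y,Z,I+1) \rightarrow path(X,Z,\_,I)$; TC11: $path(X,Y,Z,I+1) \rightarrow edge(Z,Y)$; TC12: $path(X,Z,W,I) \wedge e(Z,Y) \rightarrow path(X,Y,Z,I+1)$; TC13: $tc(X,Y) \rightarrow path(X,Y,\_,\_)$; TC14: $path(X,Y,Z,I) \rightarrow tc(X,Y)$. -}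

module Defs where

open import Data.Nat using (ℕ; zero; suc; _+_; _<_; _⊔_)
open import Data.Fin using (Fin; toℕ; fromℕ; inject₁)
  renaming (zero to fzero; suc to fsuc)
open import Data.Bool using (Bool; true; false)
open import Data.Product using (Σ; _×_; ∃)
open import Data.Sum using (_⊎_)
open import Data.Unit using (⊤)
open import Data.Empty using (⊥)
open import Relation.Nullary using (¬_)
open import Relation.Binary.PropositionalEquality using (_≡_)

Graph : ℕ → Set
Graph n = Fin n → Fin n → Bool

Adj : ∀ {n} → Graph n → Fin n → Fin n → Set
Adj E v w = E v w ≡ true

NoLoops : ∀ {n} → Graph n → Set
NoLoops E = ∀ v → E v v ≡ false

-- A directed path (sequence of vertices v₀,…,vᵢ, consecutive ones joined
-- by edges; vertices may repeat) of length i = suc m from x to y whose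
-- last-but-one vertex is z.
PathWithPen : ∀ {n} → Graph n → Fin n → Fin n → Fin n → (m : ℕ) → Set
PathWithPen {n} E x y z m =
  Σ (Fin (suc (suc m)) → Fin n) λ p →
    (p fzero ≡ x) × (p (fromℕ (suc m)) ≡ y) ×
    (∀ (k : Fin (suc m)) → Adj E (p (inject₁ k)) (p (fsuc k))) ×
    (p (inject₁ (fromℕ m)) ≡ z)

TC : ∀ {n} → Graph n → Fin n → Fin n → Set
TC {n} E x y = Σ ℕ λ m →
  Σ (Fin (suc (suc m)) → Fin n) λ p →
    (p fzero ≡ x) × (p (fromℕ (suc m)) ≡ y) ×
    (∀ (k : Fin (suc m)) → Adj E (p (inject₁ k)) (p (fsuc k)))

-- Constants of the Herbrand universe of (D_tc(G), P_tc): the vertices,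
-- and the integers 1..n of D_tc(G) together with the constant 1 of P_tc,
-- i.e. the integers 1..max(n,1).  An index constant c : Fin (n ⊔ 1)
-- denotes the integer suc (toℕ c).

data Const (n : ℕ) : Set where
  vert : Fin n → Const n
  num  : Fin (n ⊔ 1) → Const n

oneIdx : ∀ n → Fin (n ⊔ 1)
oneIdx zero    = fzero
oneIdx (suc n) = fzero

one : ∀ {n} → Const n
one {n} = num (oneIdx n)

-- the predefined relation +(I,1,J), i.e. J = I + 1
Succ : ∀ {n} → Const n → Const n → Set
Succ (num i) (num j) = toℕ j ≡ suc (toℕ i)
Succ _ _ = ⊥

data Atom (n : ℕ) : Set where
  vtx   : Const n → Atom n
  edge  : Const n → Const n → Atom n
  index : Const n → Atom n
  path  : Const n → Const n → Const n → Const n → Atom n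
  tc    : Const n → Const n → Atom n

InD : ∀ {n} → Graph n → Atom n → Set
InD E (vtx (vert v)) = ⊤
InD E (edge (vert v) (vert w)) = Adj E v w
InD {n} E (index (num i)) = suc (toℕ i) Data.Nat.≤ n
InD E _ = ⊥

-- Atoms whose relation symbol is a data relation (vtx, edge, index),
-- to which the closed-world assumption cl(D) applies.
DataRel : ∀ {n} → Atom n → Set
DataRel (vtx _) = ⊤
DataRel (edge _ _) = ⊤
DataRel (index _) = ⊤
DataRel _ = ⊥

-- A set of ground atoms is its
-- characteristic function M; every rule is read with all its variables
-- ranging over the universe, underscores read existentially, I+1
-- expanded as a fresh variable J with +(I,1,J).

module _ {n : ℕ} (E : Graph n) (M : Atom n → Bool) where

  private
    T : Atom n → Set
    T a = M a ≡ true

  record IsModel : Set where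
    field
      cl-pos : ∀ a → InD E a → T a
      cl-neg : ∀ a → DataRel a → ¬ InD E a → ¬ T a
      tc1  : ∀ x y z i → T (path x y z i) → T (vtx x)
      tc2  : ∀ x y z i → T (path x y z i) → T (vtx y)
      tc3  : ∀ x y z i → T (path x y z i) → T (vtx z)
      tc4  : ∀ x y z i → T (path x y z i) → T (index i)
      tc5  : ∀ x y → T (tc x y) → T (vtx x)
      tc6  : ∀ x y → T (tc x y) → T (vtx y)
      tc7  : ∀ x y → T (path x y x one) → T (edge x y)
      tc8  : ∀ x y → T (edge x y) → T (path x y x one)
      tc9  : ∀ x y z → T (path x y z one) → x ≡ z
      tc10 : ∀ x y z i j → Succ i j → T (path x y z j) →
               Σ (Const n) λ w → T (path x z w i)
      tc11 : ∀ x y z i j → Succ i j → T (path x y z j) → T (edge z y)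
      tc12 : ∀ x y z w i j → Succ i j → T (path x z w i) → T (edge z y) →
               T (path x y z j)
      tc13 : ∀ x y → T (tc x y) →
               Σ (Const n) λ w → Σ (Const n) λ i → T (path x y w i)
      tc14 : ∀ x y z i → T (path x y z i) → T (tc x y)

Intended : ∀ {n} → Graph n → Atom n → Set
Intended E (path (vert x) (vert y) (vert z) (num i)) = PathWithPen E x y z (toℕ i)
Intended E (path _ _ _ _) = ⊥
Intended E (tc (vert x) (vert y)) = TC E x y
Intended E (tc _ _) = ⊥
Intended E a = InD E a

{-# OPTIONS --safe #-}
module Submission where

-- In any model, TC7-TC9 say that path(x,y,z,1) holds exactly when (x,y) is an edge and
-- z = x, and TC10-TC12 say that path(x,y,z,i+1) holds exactly when some path(x,z,w,i)
-- holds and (z,y) is an edge; so by induction on i, path(x,y,z,i) holds iff some walk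
-- of length i goes from x to y with last edge leaving z.  The closed-world assumption
-- fixes the data atoms, TC1-TC6 exclude arguments of the wrong sort, and TC13/TC14 then
-- fix tc.  Conversely the intended atoms form a model; the one rule needing thought is
-- TC13, which needs some walk from x to y to have a length available as an index:
-- cutting cycles out of a walk leaves at most |V| edges.

open import Defs
open import Data.Nat using (ℕ; zero; suc; _<_; _≤_; _⊔_; _≤?_)
open import Data.Nat.Properties using (⊔-identityʳ; m≤m⊔n; ≤-trans; <⇒≤)
open import Data.Fin using (Fin; toℕ; fromℕ<; _≟_) renaming (zero to fzero; suc to fsuc)
open import Data.Fin.Properties
  using (any?; injective⇒≤; toℕ<n; toℕ-fromℕ<; toℕ-injective)
open import Data.Bool using (Bool; true)
open import Data.Bool.Properties using (T-≡; ⇔→≡) renaming (_≟_ to _≟ᵇ_)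
open import Data.Product using (Σ; ∃; ∃₂; _×_; _,_; proj₁; proj₂; map₂)
open import Data.Sum using (inj₁; inj₂; swap)
open import Data.Unit using (tt)
open import Data.Vec using (Vec; []; _∷_)
open import Data.Vec.Relation.Unary.Any using (here; there)
open import Data.Vec.Relation.Unary.All using (decide; [])
open import Data.Vec.Membership.Propositional using (_∈_)
open import Data.Vec.Relation.Unary.Unique.Propositional using (Unique; []; _∷_)
open import Data.Vec.Relation.Unary.Unique.Propositional.Properties using (lookup-injective)
open import Function using (_∘_)
open import Function.Bundles using (_⇔_; mk⇔; Equivalence)
import Function.Properties.Equivalence as ⇔
open import Relation.Binary.Definitions using (Decidable)
open import Relation.Nullary.Decidable
  using (Dec; yes; no; map′; _×-dec_; toSum; isYes; toWitness; fromWitness; decidable-stable)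
open import Relation.Binary.PropositionalEquality using (_≡_; refl; sym; trans; cong; subst)

private
  variable
    n m : ℕ
    x x′ y z w : Fin n
    i : Fin (n ⊔ 1)
    X Y Z W I J : Const n
    a : Atom n
    E : Graph n

-- The paper's path(x, y, z, m + 1): m + 1 steps from x to y, the last one leaving z.
data Walk {n : ℕ} (R : Fin n → Fin n → Set) : Fin n → Fin n → Fin n → ℕ → Set where
  [_] : R x y → Walk R x y x 0
  _∷_ : R x x′ → Walk R x′ y z m → Walk R x y z (suc m)

infixr 5 _∷_

Reachable : {n : ℕ} → (Fin n → Fin n → Set) → Fin n → Fin n → Set
Reachable R x y = ∃₂ λ z m → Walk R x y z m

module _ {n : ℕ} {R : Fin n → Fin n → Set} where

  infixl 5 _∷ʳ_

  _∷ʳ_ : Walk R x z w m → R z y → Walk R x y z (suc m)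
  [ a ]   ∷ʳ b = a ∷ [ b ]
  (a ∷ p) ∷ʳ b = a ∷ (p ∷ʳ b)

  unsnoc : Walk R x y z (suc m) → (∃ λ w → Walk R x z w m) × R z y
  unsnoc (a ∷ [ b ]) = (_ , [ a ]) , b
  unsnoc (a ∷ p@(_ ∷ _)) with (w , q) , b ← unsnoc p = (w , a ∷ q) , b

  walk? : Decidable R → ∀ x y z m → Dec (Walk R x y z m)
  walk? R? x y z zero =
    map′ (λ { (a , refl) → [ a ] }) (λ { [ a ] → a , refl }) (R? x y ×-dec x ≟ z)
  walk? R? x y z (suc m) =
    map′ (λ ((_ , p) , b) → p ∷ʳ b) unsnoc (any? (λ w → walk? R? x z w m) ×-dec R? z y)

  starts : Walk R x y z m → Vec (Fin n) (suc m)
  starts {x = x} [ _ ]   = x ∷ []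
  starts {x = x} (_ ∷ p) = x ∷ starts p

  SimpleWalk : Fin n → Fin n → Fin n → Set
  SimpleWalk x y z = Σ ℕ λ m → Σ (Walk R x y z m) λ p → Unique (starts p)

  suffix : (p : Walk R x′ y z m) → Unique (starts p) → x ∈ starts p → SimpleWalk x y z
  suffix [ a ]   u       (here refl)  = _ , [ a ] , u
  suffix (a ∷ p) u       (here refl)  = _ , a ∷ p , u
  suffix [ _ ]   _       (there ())
  suffix (_ ∷ p) (_ ∷ u) (there x∈p) = suffix p u x∈p

  simplify : Walk R x y z m → SimpleWalk x y z
  simplify [ a ] = _ , [ a ] , [] ∷ []
  simplify {x = x} (a ∷ p) with m , q , u ← simplify p
    with decide (λ v → swap (toSum (x ≟ v))) (starts q)
  ... | inj₂ x∈q = suffix q u x∈q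
  ... | inj₁ x∉q = suc m , a ∷ q , x∉q ∷ u

  simple⇒length< : (p : Walk R x y z m) → Unique (starts p) → m < n
  simple⇒length< p u = injective⇒≤ (lookup-injective u _ _)

  shorten : Walk R x y z m → ∃ λ m′ → m′ < n × Walk R x y z m′
  shorten p with m , q , u ← simplify p = m , simple⇒length< q u , q

  reachable? : Decidable R → Decidable (Reachable R)
  reachable? R? x y =
    map′ (λ (z , k , p) → z , toℕ k , p) bounded
         (any? λ z → any? λ k → walk? R? x y z (toℕ k))
    where
    bounded : Reachable R x y → ∃₂ λ z (k : Fin _) → Walk R x y z (toℕ k)
    bounded (z , _ , p) with m , m<n , q ← shorten p =
      z , fromℕ< m<n , subst (Walk R x y z) (sym (toℕ-fromℕ< m<n)) q

walk⇒pathWithPen : Walk (Adj E) x y z m → PathWithPen E x y z m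
walk⇒pathWithPen {x = x} {y = y} [ a ] = vertices , refl , refl , (λ { fzero → a }) , refl
  where
  vertices : Fin 2 → Fin _
  vertices fzero    = x
  vertices (fsuc _) = y
walk⇒pathWithPen {x = x} (a ∷ p) with q , refl , q-end , adj , q-pen ← walk⇒pathWithPen p =
  (λ { fzero → x ; (fsuc k) → q k }) , refl , q-end ,
  (λ { fzero → a ; (fsuc k) → adj k }) , q-pen

pathWithPen⇒walk : PathWithPen E x y z m → Walk (Adj E) x y z m
pathWithPen⇒walk {m = zero}  (p , refl , refl , adj , refl) = [ adj fzero ]
pathWithPen⇒walk {m = suc m} (p , refl , refl , adj , refl) =
  adj fzero ∷ pathWithPen⇒walk (p ∘ fsuc , refl , refl , adj ∘ fsuc , refl)

TC⇔Reachable : TC E x y ⇔ Reachable (Adj E) x y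
TC⇔Reachable = mk⇔
  (λ (m , p , p₀ , pₑ , adj) → _ , m , pathWithPen⇒walk (p , p₀ , pₑ , adj , refl))
  (λ (_ , m , q) → let (p , p₀ , pₑ , adj , _) = walk⇒pathWithPen q
                    in m , p , p₀ , pₑ , adj)

-- Intended E with walks for PathWithPen, as a family whose constructors expose the sorts
-- of the arguments.
data Holds {n : ℕ} (E : Graph n) : Atom n → Set where
  vtx   : (x : Fin n) → Holds E (vtx (vert x))
  edge  : Adj E x y → Holds E (edge (vert x) (vert y))
  index : suc (toℕ i) ≤ n → Holds E (index (num i))
  path  : Walk (Adj E) x y z (toℕ i) → Holds E (path (vert x) (vert y) (vert z) (num i))
  tc    : Reachable (Adj E) x y → Holds E (tc (vert x) (vert y))

holds? : (E : Graph n) (a : Atom n) → Dec (Holds E a)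
holds? E (vtx (vert x))           = yes (vtx x)
holds? E (vtx (num _))            = no λ ()
holds? E (edge (vert x) (vert y)) = map′ edge (λ { (edge e) → e }) (E x y ≟ᵇ true)
holds? E (edge (vert _) (num _))  = no λ ()
holds? E (edge (num _) _)         = no λ ()
holds? E (index (vert _))         = no λ ()
holds? {n} E (index (num i))      = map′ index (λ { (index le) → le }) (suc (toℕ i) ≤? n)
holds? E (path (vert x) (vert y) (vert z) (num i)) =
  map′ path (λ { (path p) → p }) (walk? (λ u v → E u v ≟ᵇ true) x y z (toℕ i))
holds? E (path (vert _) (vert _) (vert _) (vert _)) = no λ ()
holds? E (path (vert _) (vert _) (num _) _)         = no λ ()
holds? E (path (vert _) (num _) _ _)                = no λ ()
holds? E (path (num _) _ _ _)                       = no λ ()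
holds? E (tc (vert x) (vert y)) =
  map′ tc (λ { (tc r) → r }) (reachable? (λ u v → E u v ≟ᵇ true) x y)
holds? E (tc (vert _) (num _)) = no λ ()
holds? E (tc (num _) _)        = no λ ()

Holds⇒Intended : Holds E a → Intended E a
Holds⇒Intended (vtx _)    = tt
Holds⇒Intended (edge e)   = e
Holds⇒Intended (index le) = le
Holds⇒Intended (path p)   = walk⇒pathWithPen p
Holds⇒Intended (tc r)     = Equivalence.from TC⇔Reachable r

Intended⇒Holds : ∀ a → Intended E a → Holds E a
Intended⇒Holds (vtx (vert x))           _  = vtx x
Intended⇒Holds (vtx (num _))            ()
Intended⇒Holds (edge (vert _) (vert _)) e  = edge e
Intended⇒Holds (edge (vert _) (num _))  ()
Intended⇒Holds (edge (num _) _)         ()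
Intended⇒Holds (index (vert _))         ()
Intended⇒Holds (index (num _))          le = index le
Intended⇒Holds (path (vert _) (vert _) (vert _) (num _)) p = path (pathWithPen⇒walk p)
Intended⇒Holds (path (vert _) (vert _) (vert _) (vert _)) ()
Intended⇒Holds (path (vert _) (vert _) (num _) _)         ()
Intended⇒Holds (path (vert _) (num _) _ _)                ()
Intended⇒Holds (path (num _) _ _ _)                       ()
Intended⇒Holds (tc (vert _) (vert _)) r = tc (Equivalence.to TC⇔Reachable r)
Intended⇒Holds (tc (vert _) (num _))  ()
Intended⇒Holds (tc (num _) _)         ()

InD⇒Holds : ∀ a → InD E a → Holds E a
InD⇒Holds (vtx _)        = Intended⇒Holds (vtx _)
InD⇒Holds (edge _ _)     = Intended⇒Holds (edge _ _)
InD⇒Holds (index _)      = Intended⇒Holds (index _)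
InD⇒Holds (path _ _ _ _) ()
InD⇒Holds (tc _ _)       ()

Holds⇒InD : Holds E a → DataRel a → InD E a
Holds⇒InD (vtx _)    _ = tt
Holds⇒InD (edge e)   _ = e
Holds⇒InD (index le) _ = le
Holds⇒InD (path _)   ()
Holds⇒InD (tc _)     ()

toℕ-oneIdx : toℕ (oneIdx n) ≡ 0
toℕ-oneIdx {zero}  = refl
toℕ-oneIdx {suc _} = refl

index-bound : Fin n → (i : Fin (n ⊔ 1)) → suc (toℕ i) ≤ n
index-bound {suc n} _ i = subst (λ k → toℕ i < suc k) (⊔-identityʳ n) (toℕ<n i)

index-of : m < n → Fin (n ⊔ 1)
index-of {n = n} m<n = fromℕ< (≤-trans m<n (m≤m⊔n n 1))

path-args : Holds E (path X Y Z I) →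
            Holds E (vtx X) × Holds E (vtx Y) × Holds E (vtx Z) × Holds E (index I)
path-args (path {x = x} {y} {z} {i} _) = vtx x , vtx y , vtx z , index (index-bound x i)

tc-args : Holds E (tc X Y) → Holds E (vtx X) × Holds E (vtx Y)
tc-args (tc {x = x} {y} _) = vtx x , vtx y

path-one : Holds E (path X Y Z one) → Holds E (edge X Y) × X ≡ Z
path-one (path p) with [ e ] ← subst (Walk _ _ _ _) toℕ-oneIdx p = edge e , refl

edge⇒path-one : Holds E (edge X Y) → Holds E (path X Y X one)
edge⇒path-one (edge e) = path (subst (Walk _ _ _ _) (sym toℕ-oneIdx) [ e ])

path-unsnoc : Holds E (path X Y Z J) → Succ I J →
              Holds E (edge Z Y) × ∃ λ W → Holds E (path X Z W I)
path-unsnoc {I = vert _} (path _) ()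
path-unsnoc {I = num _}  (path p) s with (w , q) , e ← unsnoc (subst (Walk _ _ _ _) s p) =
  edge e , vert w , path q

path-snoc : Holds E (path X Z W I) → Holds E (edge Z Y) → Succ I J → Holds E (path X Y Z J)
path-snoc {J = vert _} (path _) _ ()
path-snoc {J = num _}  (path p) (edge e) s = path (subst (Walk _ _ _ _) (sym s) (p ∷ʳ e))

tc⇒path : Holds E (tc X Y) → ∃₂ λ W I → Holds E (path X Y W I)
tc⇒path (tc (z , _ , p)) with m , m<n , q ← shorten p =
  vert z , num (index-of m<n) , path (subst (Walk _ _ _ _) (sym (toℕ-fromℕ< _)) q)

path⇒tc : Holds E (path X Y Z I) → Holds E (tc X Y)
path⇒tc (path p) = tc (_ , _ , p)

intended : Graph n → Atom n → Bool
intended E a = isYes (holds? E a)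

intended⇔Holds : ∀ a → intended E a ≡ true ⇔ Holds E a
intended⇔Holds {E = E} a =
  ⇔.trans (⇔.sym T-≡) (mk⇔ toWitness (fromWitness {a? = holds? E a}))

intended-isModel : (E : Graph n) → IsModel E (intended E)
intended-isModel E = record
  { cl-pos = λ a → complete ∘ InD⇒Holds a
  ; cl-neg = λ a d a∉D → a∉D ∘ (λ h → Holds⇒InD h d) ∘ sound
  ; tc1    = λ _ _ _ _ → complete ∘ proj₁ ∘ path-args ∘ sound
  ; tc2    = λ _ _ _ _ → complete ∘ proj₁ ∘ proj₂ ∘ path-args ∘ sound
  ; tc3    = λ _ _ _ _ → complete ∘ proj₁ ∘ proj₂ ∘ proj₂ ∘ path-args ∘ sound
  ; tc4    = λ _ _ _ _ → complete ∘ proj₂ ∘ proj₂ ∘ proj₂ ∘ path-args ∘ sound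
  ; tc5    = λ _ _ → complete ∘ proj₁ ∘ tc-args ∘ sound
  ; tc6    = λ _ _ → complete ∘ proj₂ ∘ tc-args ∘ sound
  ; tc7    = λ _ _ → complete ∘ proj₁ ∘ path-one ∘ sound
  ; tc8    = λ _ _ → complete ∘ edge⇒path-one ∘ sound
  ; tc9    = λ _ _ _ → proj₂ ∘ path-one ∘ sound
  ; tc10   = λ _ _ _ _ _ s t → map₂ complete (proj₂ (path-unsnoc (sound t) s))
  ; tc11   = λ _ _ _ _ _ s t → complete (proj₁ (path-unsnoc (sound t) s))
  ; tc12   = λ _ _ _ _ _ _ s t e → complete (path-snoc (sound t) (sound e) s)
  ; tc13   = λ _ _ t → let (w , i , h) = tc⇒path (sound t) in w , i , complete h
  ; tc14   = λ _ _ _ _ → complete ∘ path⇒tc ∘ sound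
  }
  where
  sound : intended E a ≡ true → Holds E a
  sound = Equivalence.to (intended⇔Holds _)
  complete : Holds E a → intended E a ≡ true
  complete = Equivalence.from (intended⇔Holds _)

module _ {n : ℕ} {E : Graph n} {M : Atom n → Bool} (M-model : IsModel E M) where
  open IsModel M-model

  private
    T : Atom n → Set
    T a = M a ≡ true

    data-sound : ∀ a → DataRel a → T a → Holds E a
    data-sound a d t = decidable-stable (holds? E a) λ ¬h → cl-neg a d (¬h ∘ InD⇒Holds a) t

    edge-sound : T (edge X Y) → Holds E (edge X Y)
    edge-sound = data-sound _ tt

    vtx-sound : T (vtx X) → Holds E (vtx X)
    vtx-sound = data-sound _ tt

    path⇔walk : ∀ m → toℕ i ≡ m →
                T (path (vert x) (vert y) (vert z) (num i)) ⇔ Walk (Adj E) x y z m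
    path⇔walk zero eq with refl ← toℕ-injective (trans eq (sym (toℕ-oneIdx {n}))) =
      mk⇔ sound complete
      where
      sound : T (path (vert x) (vert y) (vert z) one) → Walk (Adj E) x y z 0
      sound t with refl ← tc9 _ _ _ t with edge e ← edge-sound (tc7 _ _ t) = [ e ]
      complete : Walk (Adj E) x y z 0 → T (path (vert x) (vert y) (vert z) one)
      complete [ e ] = tc8 _ _ (cl-pos _ e)
    path⇔walk {i = j} {x = x} {y = y} {z = z} (suc m) eq = mk⇔ sound complete
      where
      m<n⊔1 : m < _
      m<n⊔1 = <⇒≤ (subst (_< _) eq (toℕ<n j))
      i′ : Fin _
      i′ = fromℕ< m<n⊔1
      s : Succ (num i′) (num j)
      s = trans eq (cong suc (sym (toℕ-fromℕ< m<n⊔1)))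
      IH : ∀ {y z} → T (path (vert x) (vert y) (vert z) (num i′)) ⇔ Walk (Adj E) x y z m
      IH = path⇔walk m (toℕ-fromℕ< m<n⊔1)
      sound : T (path (vert x) (vert y) (vert z) (num j)) → Walk (Adj E) x y z (suc m)
      sound t with _ , t′ ← tc10 _ _ _ _ _ s t
        with vtx _ ← vtx-sound (tc3 _ _ _ _ t′) | edge e ← edge-sound (tc11 _ _ _ _ _ s t)
        = Equivalence.to IH t′ ∷ʳ e
      complete : Walk (Adj E) x y z (suc m) → T (path (vert x) (vert y) (vert z) (num j))
      complete p with (_ , q) , e ← unsnoc p =
        tc12 _ _ _ _ _ _ s (Equivalence.from IH q) (cl-pos _ e)

    path-sound : T (path X Y Z I) → Holds E (path X Y Z I)
    path-sound t
      with vtx _ ← vtx-sound (tc1 _ _ _ _ t) | vtx _ ← vtx-sound (tc2 _ _ _ _ t)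
         | vtx _ ← vtx-sound (tc3 _ _ _ _ t) | index _ ← data-sound _ tt (tc4 _ _ _ _ t)
      = path (Equivalence.to (path⇔walk _ refl) t)

    sound : ∀ a → T a → Holds E a
    sound (vtx _)        = data-sound _ tt
    sound (edge _ _)     = data-sound _ tt
    sound (index _)      = data-sound _ tt
    sound (path _ _ _ _) = path-sound
    sound (tc _ _) t with _ , _ , t′ ← tc13 _ _ t with path p ← path-sound t′ =
      tc (_ , _ , p)

    complete : Holds E a → T a
    complete (vtx _)    = cl-pos _ tt
    complete (edge e)   = cl-pos _ e
    complete (index le) = cl-pos _ le
    complete (path p)   = Equivalence.from (path⇔walk _ refl) p
    complete (tc r) with _ , _ , path p ← tc⇒path {E = E} (tc r) =
      tc14 _ _ _ _ (Equivalence.from (path⇔walk _ refl) p)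

  model⇔Holds : ∀ a → M a ≡ true ⇔ Holds E a
  model⇔Holds a = mk⇔ (sound a) complete

models-agree : {E : Graph n} {M M′ : Atom n → Bool} →
               IsModel E M → IsModel E M′ → ∀ a → M a ≡ M′ a
models-agree M-model M′-model a =
  ⇔→≡ (⇔.trans (model⇔Holds M-model a) (⇔.sym (model⇔Holds M′-model a)))

proposition6 : (n : ℕ) (E : Graph n) → NoLoops E →
  Σ (Atom n → Bool) λ M →
    IsModel E M ×
    (∀ a → (M a ≡ true) ⇔ Intended E a) ×
    (∀ (M′ : Atom n → Bool) → IsModel E M′ → ∀ a → M′ a ≡ M a)
proposition6 n E _ =
  intended E , intended-isModel E ,
  (λ a → ⇔.trans (intended⇔Holds a) (mk⇔ Holds⇒Intended (Intended⇒Holds a))) ,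
  (λ M′ M′-model → models-agree M′-model (intended-isModel E))
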